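{- Let $G$ be an edge-colored graph on $9$ vertices. If $e(G)+c(G)=64$ and $G$ contains no rainbow $K_5$, then $G$ is complete.
   Context: Graphs are simple; edge colorings are arbitrary (not necessarily proper). $e(G)$ is the number of edges and $c(G)$ the number of distinct colors of $G$. A rainbow $K_5$ is a complete subgraph on $5$ vertices whose ten edges have pairwise distinct colors. -}

module Defs where

open import Data.Nat using (ℕ; _+_)
open import Data.Nat.Properties using (_≟_)
open import Data.Fin using (Fin; _<_)
open import Data.Fin.Properties using (_<?_)
open import Data.List using (List; length; filter; map; deduplicate; cartesianProduct; allFin)
open import Data.Product using (_×_; _,_; proj₁; proj₂)
open import Relation.Binary.PropositionalEquality using (_≡_; _≢_)
open import Relation.Nullary using (¬_; Dec)
open import Relation.Nullary.Decidable using (_×-dec_)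

-- A simple graph on vertex set Fin n whose edges carry colors (natural numbers).
-- The coloring is arbitrary (not necessarily proper); only colors of edges matter.
record ColoredGraph (n : ℕ) : Set₁ where
  field
    Adj     : Fin n → Fin n → Set
    adj?    : (u v : Fin n) → Dec (Adj u v)
    irrefl  : ∀ u → ¬ Adj u u
    sym     : ∀ {u v} → Adj u v → Adj v u
    color   : Fin n → Fin n → ℕ
    colSym  : ∀ u v → color u v ≡ color v u

module _ {n : ℕ} (G : ColoredGraph n) where
  open ColoredGraph G

  edgeList : List (Fin n × Fin n)
  edgeList = filter (λ p → (proj₁ p <? proj₂ p) ×-dec adj? (proj₁ p) (proj₂ p))
                    (cartesianProduct (allFin n) (allFin n))

  e : ℕ
  e = length edgeList

  c : ℕ
  c = length (deduplicate _≟_ (map (λ p → color (proj₁ p) (proj₂ p)) edgeList))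

  Complete : Set
  Complete = ∀ u v → u ≢ v → Adj u v

  RainbowK : (k : ℕ) → Set
  RainbowK k =
    Data.Product.Σ (Fin k → Fin n) λ f →
      (∀ i j → i ≢ j → f i ≢ f j) ×
      (∀ i j → i ≢ j → Adj (f i) (f j)) ×
      (∀ i j i' j' → i < j → i' < j' → (i , j) ≢ (i' , j') →
         color (f i) (f j) ≢ color (f i') (f j'))

{-# OPTIONS --safe #-}
module Submission where

-- For a vertex set S let weight(S) = e(S) + c(S) + [G[S] is not complete]. Removing a vertex w
-- from S loses deg(w) edges, at most the colors owned by w (those all of whose edges in S
-- contain w), and the last term drops by at most the number of non-neighbours of w, so
-- weight(S) ≤ owned(w) + weight(S - w) + |S| - 1. A color is owned by at most two vertices,
-- and by at most one if it appears twice, so summing over w ∈ S bounds |S| · weight(S) by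
-- 2 c(S) - (number of repeated colors) + |S| (B + |S| - 1), where B bounds the weight of the
-- (|S| - 1)-subsets. If every color appears once and S has at most |S| - 5 non-edges, deleting
-- an endpoint of each non-edge leaves a rainbow K₅. A finite check over the possible
-- (e, c, repeated colors) then gives the bounds 0, 0, 2, 6, 12, 19, 28, 38, 50, 64 for
-- |S| = 0, …, 9; at |S| = 7 one exceptional profile is excluded by looking at the owner of the
-- unique repeated color. For S = V(G) this says e(G) + c(G) + [G incomplete] ≤ 64.

open import Defs

open import Data.Bool using (Bool; true; false; _∧_; _∨_; not; T; if_then_else_)
open import Data.Bool.ListAction using (any)
open import Data.Bool.Properties using (T-∧; T-≡; ∧-identityʳ; ∧-zeroʳ; ∧-assoc; ∧-comm)
open import Data.Empty using (⊥; ⊥-elim)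
open import Data.Fin using (Fin; zero; suc)
import Data.Fin as Fin
import Data.Fin.Properties as F
open import Data.List using (List; []; _∷_; _++_; length; map; filter; filterᵇ; findᵇ; allFin; cartesianProduct; deduplicate)
open import Data.List.Membership.Propositional using (_∈_; lose)
open import Data.List.Membership.Propositional.Properties
  using ( ∈-map⁺; ∈-map⁻; ∈-deduplicate⁻; ∈-allFin; ∈-cartesianProduct⁺; ∈-∃++; ∈-++⁻; ∈-++⁺ˡ; ∈-++⁺ʳ
        ; ∈-filter⁺; ∈-filter⁻)
open import Data.List.Properties using (map-cong; length-++; length-map)
import Data.List.Relation.Unary.All as All
open import Data.List.Relation.Unary.Any using (here; there; satisfied)
open import Data.List.Relation.Unary.Any.Properties using (any⁺; any⁻)
open import Data.List.Relation.Unary.Unique.DecPropositional.Properties using (deduplicate-!)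
open import Data.List.Relation.Unary.Unique.Propositional using (Unique; []; _∷_)
import Data.List.Relation.Unary.Unique.Propositional.Properties as Unique
open import Data.Maybe using (Maybe; just; fromMaybe)
import Data.Maybe.Properties as Maybe
open import Data.Maybe.Properties using (just-injective)
open import Data.Nat using (ℕ; zero; suc; _+_; _*_; _∸_; _⊓_; _≤_; _<_; z≤n; s≤s; _≡ᵇ_; _≟_; _≤?_; _<?_)
open import Data.Nat.Combinatorics using (_C_; nC1≡n; nCk+nC[k+1]≡[n+1]C[k+1])
open import Data.Nat.ListAction using (sum)
import Data.Nat.Properties as ℕₚ
open import Data.Nat.Properties using (allUpTo?)
open import Algebra.Properties.CommutativeSemigroup ℕₚ.+-commutativeSemigroup
  using () renaming (interchange to +-interchange)
open import Data.Nat.Tactic.RingSolver using (solve-∀)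
open import Data.Product using (Σ; ∃; ∃₂; _×_; _,_; proj₁; proj₂)
import Data.Product.Properties as Product
open import Data.Sum using (_⊎_; inj₁; inj₂)
open import Function using (id; _∘_; Injective)
open import Function.Bundles using (Equivalence)
open import Relation.Binary.Definitions using (DecidableEquality; tri<; tri≈; tri>)
open import Relation.Binary.PropositionalEquality
  using (_≡_; _≢_; refl; sym; trans; cong; cong₂; subst; subst₂; module ≡-Reasoning)
open import Relation.Nullary using (¬_; Dec; yes; no; does)
open import Relation.Nullary.Decidable
  using (T?; ⌊_⌋; True; toWitness; fromWitness; from-yes; isYes≗does; _×-dec_; _⊎-dec_; _→-dec_)
open import Relation.Unary using (Decidable)

𝟙 : Bool → ℕ
𝟙 true  = 1
𝟙 false = 0

𝟙-mono : ∀ {a b} → (T a → T b) → 𝟙 a ≤ 𝟙 b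
𝟙-mono {false}         _ = z≤n
𝟙-mono {true} {true}   _ = ℕₚ.≤-refl
𝟙-mono {true} {false} f = ⊥-elim (f _)

¬T⇒T-not : ∀ b → ¬ T b → T (not b)
¬T⇒T-not false _  = _
¬T⇒T-not true  ¬t = ¬t _

T-not⇒¬T : ∀ b → T (not b) → ¬ T b
T-not⇒¬T false _ ()
T-not⇒¬T true  ()

∧-swapʳ : ∀ a b c → ((a ∧ b) ∧ c) ≡ ((a ∧ c) ∧ b)
∧-swapʳ a b c = trans (∧-assoc a b c) (trans (cong (a ∧_) (∧-comm b c)) (sym (∧-assoc a c b)))

+-⊓1 : ∀ a b → (a + b) ⊓ 1 ≤ a ⊓ 1 + b
+-⊓1 zero    b = ℕₚ.m⊓n≤m b 1
+-⊓1 (suc a) b = s≤s (subst (_≤ a ⊓ 0 + b) (sym (ℕₚ.⊓-zeroʳ (a + b))) z≤n)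

⊓1≡0⇒≡0 : ∀ {n} → n ⊓ 1 ≡ 0 → n ≡ 0
⊓1≡0⇒≡0 {zero}  _  = refl
⊓1≡0⇒≡0 {suc _} ()

∑ : {A : Set} → List A → (A → ℕ) → ℕ
∑ xs f = sum (map f xs)

syntax ∑ xs (λ x → e) = ∑[ x ← xs ] e

count : {A : Set} → (A → Bool) → List A → ℕ
count P xs = ∑[ x ← xs ] 𝟙 (P x)

module _ {A : Set} where

  ∑-cong : ∀ xs {f g : A → ℕ} → (∀ x → f x ≡ g x) → ∑ xs f ≡ ∑ xs g
  ∑-cong xs f≗g = cong sum (map-cong f≗g xs)

  ∑-mono-≤ : ∀ xs {f g : A → ℕ} → (∀ x → f x ≤ g x) → ∑ xs f ≤ ∑ xs g
  ∑-mono-≤ []       f≤g = z≤n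
  ∑-mono-≤ (x ∷ xs) f≤g = ℕₚ.+-mono-≤ (f≤g x) (∑-mono-≤ xs f≤g)

  ∑-zero : ∀ (xs : List A) → ∑[ x ← xs ] 0 ≡ 0
  ∑-zero []       = refl
  ∑-zero (x ∷ xs) = ∑-zero xs

  ∑-distrib-+ : ∀ xs (f g : A → ℕ) → ∑[ x ← xs ] (f x + g x) ≡ ∑ xs f + ∑ xs g
  ∑-distrib-+ []       f g = refl
  ∑-distrib-+ (x ∷ xs) f g = begin
    f x + g x + ∑[ x ← xs ] (f x + g x) ≡⟨ cong (f x + g x +_) (∑-distrib-+ xs f g) ⟩
    f x + g x + (∑ xs f + ∑ xs g)       ≡⟨ +-interchange (f x) (g x) (∑ xs f) (∑ xs g) ⟩
    f x + ∑ xs f + (g x + ∑ xs g)       ∎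
    where open ≡-Reasoning

  *-distribˡ-∑ : ∀ k xs (f : A → ℕ) → k * ∑ xs f ≡ ∑[ x ← xs ] (k * f x)
  *-distribˡ-∑ k []       f = ℕₚ.*-zeroʳ k
  *-distribˡ-∑ k (x ∷ xs) f =
    trans (ℕₚ.*-distribˡ-+ k (f x) (∑ xs f)) (cong (k * f x +_) (*-distribˡ-∑ k xs f))

∑-comm : {A B : Set} (xs : List A) (ys : List B) (f : A → B → ℕ) →
         ∑[ x ← xs ] ∑[ y ← ys ] f x y ≡ ∑[ y ← ys ] ∑[ x ← xs ] f x y
∑-comm [] ys f = sym (∑-zero ys)
∑-comm (x ∷ xs) ys f = begin
  ∑[ y ← ys ] f x y + ∑[ x ← xs ] ∑[ y ← ys ] f x y ≡⟨ cong (∑[ y ← ys ] f x y +_) (∑-comm xs ys f) ⟩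
  ∑[ y ← ys ] f x y + ∑[ y ← ys ] ∑[ x ← xs ] f x y ≡⟨ sym (∑-distrib-+ ys (f x) _) ⟩
  ∑[ y ← ys ] (f x y + ∑[ x ← xs ] f x y)           ∎
  where open ≡-Reasoning

module _ {A : Set} where

  count-cong : ∀ xs {P Q : A → Bool} → (∀ x → P x ≡ Q x) → count P xs ≡ count Q xs
  count-cong xs P≗Q = ∑-cong xs (cong 𝟙 ∘ P≗Q)

  count-mono : ∀ xs {P Q : A → Bool} → (∀ {x} → T (P x) → T (Q x)) → count P xs ≤ count Q xs
  count-mono xs P⇒Q = ∑-mono-≤ xs (λ _ → 𝟙-mono P⇒Q)

  count-∨ : ∀ xs (P Q : A → Bool) → count (λ x → P x ∨ Q x) xs ≤ count P xs + count Q xs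
  count-∨ xs P Q = ℕₚ.≤-trans (∑-mono-≤ xs (λ x → 𝟙-∨ (P x) (Q x))) (ℕₚ.≤-reflexive (∑-distrib-+ xs _ _))
    where
    𝟙-∨ : ∀ a b → 𝟙 (a ∨ b) ≤ 𝟙 a + 𝟙 b
    𝟙-∨ false b = ℕₚ.≤-refl
    𝟙-∨ true  b = s≤s z≤n

  count-split : ∀ xs (P Q : A → Bool) →
                count P xs ≡ count (λ x → P x ∧ Q x) xs + count (λ x → P x ∧ not (Q x)) xs
  count-split xs P Q = trans (∑-cong xs (λ x → 𝟙-split (P x) (Q x))) (∑-distrib-+ xs _ _)
    where
    𝟙-split : ∀ a b → 𝟙 a ≡ 𝟙 (a ∧ b) + 𝟙 (a ∧ not b)
    𝟙-split false b     = refl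
    𝟙-split true  false = refl
    𝟙-split true  true  = refl

  count≥1 : ∀ {xs x} {P : A → Bool} → x ∈ xs → T (P x) → 1 ≤ count P xs
  count≥1 {x ∷ xs} {P = P} (here refl) Px with P x
  ... | true = s≤s z≤n
  count≥1 {y ∷ xs} (there x∈xs) Px = ℕₚ.≤-trans (count≥1 x∈xs Px) (ℕₚ.m≤n+m _ _)

  count-none : ∀ xs {P : A → Bool} → (∀ x → ¬ T (P x)) → count P xs ≡ 0
  count-none []       _  = refl
  count-none (x ∷ xs) {P} ¬P with P x in eq
  ... | true  = ⊥-elim (¬P x (subst T (sym eq) _))
  ... | false = count-none xs ¬P

  count-∃ : ∀ xs {P : A → Bool} → 1 ≤ count P xs → ∃ λ x → x ∈ xs × T (P x)
  count-∃ (x ∷ xs) {P} h with P x in eq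
  ... | true  = x , here refl , subst T (sym eq) _
  ... | false = let (y , y∈xs , Py) = count-∃ xs h in y , there y∈xs , Py

  count≥2 : ∀ {xs x y} {P : A → Bool} → x ≢ y → x ∈ xs → y ∈ xs → T (P x) → T (P y) →
            2 ≤ count P xs
  count≥2 x≢y (here refl) (here refl) _ _ = ⊥-elim (x≢y refl)
  count≥2 {P = P} x≢y (here {x = x} refl) (there y∈xs) Px Py with P x
  ... | true = s≤s (count≥1 y∈xs Py)
  count≥2 {P = P} x≢y (there x∈xs) (here {x = y} refl) Px Py with P y
  ... | true = s≤s (count≥1 x∈xs Px)
  count≥2 x≢y (there x∈xs) (there y∈xs) Px Py =
    ℕₚ.≤-trans (count≥2 x≢y x∈xs y∈xs Px Py) (ℕₚ.m≤n+m _ _)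

  distinct-witnesses : ∀ {xs} {P : A → Bool} → Unique xs → 2 ≤ count P xs →
                       ∃₂ λ x y → x ≢ y × T (P x) × T (P y)
  distinct-witnesses {x ∷ xs} {P} (x∉xs ∷ xs!) h with P x in eq
  ... | true  = let (y , y∈xs , Py) = count-∃ xs (ℕₚ.≤-pred h)
                in x , y , All.lookup x∉xs y∈xs , subst T (sym eq) _ , Py
  ... | false = distinct-witnesses xs! h

  count-≟ : (_≟_ : DecidableEquality A) → ∀ {xs x} → Unique xs → x ∈ xs →
            count (λ y → ⌊ y ≟ x ⌋) xs ≡ 1
  count-≟ _≟_ {xs} {x} xs! x∈xs =
    ℕₚ.≤-antisym (ℕₚ.≮⇒≥ two-copies) (count≥1 x∈xs (fromWitness refl))
    where
    two-copies : ¬ 1 < count (λ y → ⌊ y ≟ x ⌋) xs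
    two-copies two with distinct-witnesses xs! two
    ... | y , z , y≢z , y≡x , z≡x = y≢z (trans (toWitness y≡x) (sym (toWitness z≡x)))

  length-filter : ∀ {P : A → Set} (P? : Decidable P) xs → length (filter P? xs) ≡ count (does ∘ P?) xs
  length-filter P? []       = refl
  length-filter P? (x ∷ xs) with does (P? x)
  ... | true  = cong suc (length-filter P? xs)
  ... | false = length-filter P? xs

module _ {A B : Set} where

  length-≤-injection : ∀ {xs : List A} {ys : List B} → Unique xs → (g : A → B) →
                       (∀ {x} → x ∈ xs → g x ∈ ys) →
                       (∀ {x x′} → x ∈ xs → x′ ∈ xs → g x ≡ g x′ → x ≡ x′) →
                       length xs ≤ length ys
  length-≤-injection {[]}     _            g g∈ g-inj = z≤n
  length-≤-injection {x ∷ xs} (x∉xs ∷ xs!) g g∈ g-inj with ∈-∃++ (g∈ (here refl))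
  ... | as , bs , refl = begin
    suc (length xs)            ≤⟨ s≤s (length-≤-injection xs! g g∈-rest (λ p q → g-inj (there p) (there q))) ⟩
    suc (length (as ++ bs))    ≡⟨ cong suc (length-++ as) ⟩
    suc (length as + length bs) ≡⟨ sym (ℕₚ.+-suc (length as) (length bs)) ⟩
    length as + length (g x ∷ bs) ≡⟨ sym (length-++ as) ⟩
    length (as ++ g x ∷ bs)    ∎
    where
    open ℕₚ.≤-Reasoning
    g∈-rest : ∀ {x′} → x′ ∈ xs → g x′ ∈ as ++ bs
    g∈-rest {x′} x′∈xs with ∈-++⁻ as (g∈ (there x′∈xs))
    ... | inj₁ p             = ∈-++⁺ˡ p
    ... | inj₂ (there p)     = ∈-++⁺ʳ as p
    ... | inj₂ (here gx′≡gx) =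
      ⊥-elim (All.lookup x∉xs x′∈xs (g-inj (here refl) (there x′∈xs) (sym gx′≡gx)))

  count-≤-injection : ∀ {xs : List A} {ys : List B} {P : A → Bool} {Q : B → Bool} →
                      Unique xs → (∀ y → y ∈ ys) → (g : A → B) →
                      (∀ {x} → T (P x) → T (Q (g x))) →
                      (∀ {x x′} → T (P x) → T (P x′) → g x ≡ g x′ → x ≡ x′) →
                      count P xs ≤ count Q ys
  count-≤-injection {xs} {ys} {P} {Q} xs! ys-complete g PQ g-inj =
    subst₂ _≤_ (length-filter (T? ∘ P) xs) (length-filter (T? ∘ Q) ys)
      (length-≤-injection (Unique.filter⁺ (T? ∘ P) xs!) g
        (λ x∈ → ∈-filter⁺ (T? ∘ Q) (ys-complete _) (PQ (satisfies x∈)))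
        (λ x∈ x′∈ → g-inj (satisfies x∈) (satisfies x′∈)))
    where
    satisfies : ∀ {x} → x ∈ filterᵇ P xs → T (P x)
    satisfies = proj₂ ∘ ∈-filter⁻ (T? ∘ P) {xs = xs}

module _ {A : Set} (P : A → Bool) where

  findᵇ-sound : ∀ xs {y} → findᵇ P xs ≡ just y → T (P y)
  findᵇ-sound (x ∷ xs) found with P x in Px
  ... | true  = subst (T ∘ P) (just-injective found) (subst T (sym Px) _)
  ... | false = findᵇ-sound xs found

  findᵇ-complete : ∀ {xs x} → x ∈ xs → T (P x) → ∃ λ y → findᵇ P xs ≡ just y
  findᵇ-complete {x ∷ xs} (here refl) Px with P x
  ... | true = x , refl
  findᵇ-complete {z ∷ xs} (there x∈xs) Px with P z
  ... | true  = z , refl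
  ... | false = findᵇ-complete x∈xs Px

<-crossed : ∀ {k} {a b c d : Fin k} → a Fin.< b → c Fin.< d → a ≡ d → b ≡ c → ⊥
<-crossed a<b c<d refl refl = F.<-asym a<b c<d

module Vertices (n : ℕ) where

  V : Set
  V = Fin n

  Pair : Set
  Pair = V × V

  vertices : List V
  vertices = allFin n

  pairs : List Pair
  pairs = cartesianProduct vertices vertices

  vertices! : Unique vertices
  vertices! = Unique.allFin⁺ n

  pairs! : Unique pairs
  pairs! = Unique.cartesianProduct⁺ vertices! vertices!

  ∈-vertices : ∀ v → v ∈ vertices
  ∈-vertices = ∈-allFin

  ∈-pairs : ∀ p → p ∈ pairs
  ∈-pairs (a , b) = ∈-cartesianProduct⁺ (∈-allFin a) (∈-allFin b)

  _==_ : V → V → Bool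
  a == b = ⌊ a F.≟ b ⌋

  ==-sym : ∀ a b → (a == b) ≡ (b == a)
  ==-sym a b with a F.≟ b | b F.≟ a
  ... | yes _   | yes _   = refl
  ... | no _    | no _    = refl
  ... | yes a≡b | no b≢a = ⊥-elim (b≢a (sym a≡b))
  ... | no a≢b  | yes b≡a = ⊥-elim (a≢b (sym b≡a))

  _≟ᵖ_ : DecidableEquality Pair
  _≟ᵖ_ = Product.≡-dec F._≟_ F._≟_

  ordered : Pair → Bool
  ordered (a , b) = ⌊ a F.<? b ⌋

  incident : V → Pair → Bool
  incident w (a , b) = w == a ∨ w == b

  Joins : Pair → V → V → Set
  Joins p a b = p ≡ (a , b) ⊎ p ≡ (b , a)

  sortPair : V → V → Pair
  sortPair a b with F.<-cmp a b
  ... | tri> _ _ _ = (b , a)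
  ... | _          = (a , b)

  sortPair-joins : ∀ a b → Joins (sortPair a b) a b
  sortPair-joins a b with F.<-cmp a b
  ... | tri< _ _ _ = inj₁ refl
  ... | tri≈ _ _ _ = inj₁ refl
  ... | tri> _ _ _ = inj₂ refl

  sortPair-ordered : ∀ {a b} → a ≢ b → T (ordered (sortPair a b))
  sortPair-ordered {a} {b} a≢b with F.<-cmp a b
  ... | tri< a<b _ _ = fromWitness a<b
  ... | tri≈ _ a≡b _ = ⊥-elim (a≢b a≡b)
  ... | tri> _ _ b<a = fromWitness b<a

  ordered⇒≢ : ∀ {a b} → T (ordered (a , b)) → a ≢ b
  ordered⇒≢ a<b refl = F.<-irrefl refl (toWitness a<b)

  joins-unique : ∀ {p q a b} → T (ordered p) → T (ordered q) → Joins p a b → Joins q a b → p ≡ q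
  joins-unique _   _   (inj₁ refl) (inj₁ refl) = refl
  joins-unique _   _   (inj₂ refl) (inj₂ refl) = refl
  joins-unique a<b b<a (inj₁ refl) (inj₂ refl) = ⊥-elim (F.<-asym (toWitness a<b) (toWitness b<a))
  joins-unique b<a a<b (inj₂ refl) (inj₁ refl) = ⊥-elim (F.<-asym (toWitness a<b) (toWitness b<a))

  joins-injective : ∀ {p w x x′} → x ≢ w → Joins p w x → Joins p w x′ → x ≡ x′
  joins-injective x≢w (inj₁ refl) (inj₁ refl) = refl
  joins-injective x≢w (inj₁ refl) (inj₂ refl) = ⊥-elim (x≢w refl)
  joins-injective x≢w (inj₂ refl) (inj₁ refl) = ⊥-elim (x≢w refl)
  joins-injective x≢w (inj₂ refl) (inj₂ refl) = refl

  joins-endpoints : ∀ {p a b c d} → Joins p a b → Joins p c d → (a ≡ c × b ≡ d) ⊎ (a ≡ d × b ≡ c)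
  joins-endpoints (inj₁ refl) (inj₁ refl) = inj₁ (refl , refl)
  joins-endpoints (inj₁ refl) (inj₂ refl) = inj₂ (refl , refl)
  joins-endpoints (inj₂ refl) (inj₁ refl) = inj₂ (refl , refl)
  joins-endpoints (inj₂ refl) (inj₂ refl) = inj₁ (refl , refl)

  incident⁻ : ∀ {w} p → T (incident w p) → w ≡ proj₁ p ⊎ w ≡ proj₂ p
  incident⁻ {w} (a , b) w∈p with w F.≟ a
  ... | yes w≡a = inj₁ w≡a
  ... | no _    = inj₂ (toWitness w∈p)

  incident-both : ∀ {x y} p → x ≢ y → T (incident x p) → T (incident y p) → Joins p x y
  incident-both {x} {y} (a , b) x≢y x∈p y∈p with incident⁻ {x} (a , b) x∈p | incident⁻ {y} (a , b) y∈p
  ... | inj₁ refl | inj₁ refl = ⊥-elim (x≢y refl)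
  ... | inj₁ refl | inj₂ refl = inj₁ refl
  ... | inj₂ refl | inj₁ refl = inj₂ refl
  ... | inj₂ refl | inj₂ refl = ⊥-elim (x≢y refl)

  joins-incident : ∀ {p a b} → Joins p a b → T (incident a p)
  joins-incident {a = a} {b} (inj₁ refl) with a F.≟ a
  ... | yes _   = _
  ... | no a≢a = ⊥-elim (a≢a refl)
  joins-incident {a = a} {b} (inj₂ refl) with a F.≟ b | a F.≟ a
  ... | yes _ | _       = _
  ... | no _  | yes _   = _
  ... | no _  | no a≢a = ⊥-elim (a≢a refl)

  other : V → Pair → V
  other w (a , b) = if a == w then b else a

  other-joins : ∀ {w} p → T (ordered p) → T (incident w p) → Joins p w (other w p) × other w p ≢ w
  other-joins {w} (a , b) a<b w∈p with a F.≟ w | incident⁻ {w} (a , b) w∈p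
  ... | yes refl | _         = inj₁ refl , ordered⇒≢ a<b ∘ sym
  ... | no a≢w   | inj₁ w≡a = ⊥-elim (a≢w (sym w≡a))
  ... | no a≢w   | inj₂ refl = inj₂ refl , a≢w

  VertexSet : Set
  VertexSet = V → Bool

  size : VertexSet → ℕ
  size S = count S vertices

  _-_ : VertexSet → V → VertexSet
  (S - w) x = S x ∧ not (x == w)

  ∈-remove⁻ : ∀ S {w x} → T ((S - w) x) → T (S x) × x ≢ w
  ∈-remove⁻ S {w} {x} h with S x | x F.≟ w
  ... | true | no x≢w = _ , x≢w

  ∈-remove⁺ : ∀ S {w x} → T (S x) → x ≢ w → T ((S - w) x)
  ∈-remove⁺ S {w} {x} x∈S x≢w with S x | x F.≟ w
  ... | true | yes x≡w = x≢w x≡w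
  ... | true | no _    = _

  size-remove : ∀ S {w} → T (S w) → size S ≡ suc (size (S - w))
  size-remove S {w} w∈S = begin
    size S                                             ≡⟨ count-split vertices S (_== w) ⟩
    count (λ x → S x ∧ x == w) vertices + size (S - w) ≡⟨ cong (_+ size (S - w)) only-w ⟩
    suc (size (S - w))                                 ∎
    where
    open ≡-Reasoning
    S∧==w : ∀ x → (S x ∧ x == w) ≡ (x == w)
    S∧==w x with x F.≟ w
    ... | yes refl = trans (∧-identityʳ (S x)) (Equivalence.to T-≡ w∈S)
    ... | no _     = ∧-zeroʳ (S x)
    only-w : count (λ x → S x ∧ x == w) vertices ≡ 1
    only-w = trans (count-cong vertices S∧==w) (count-≟ F._≟_ vertices! (∈-vertices w))

  pairIn : VertexSet → Pair → Bool
  pairIn S (a , b) = ordered (a , b) ∧ (S a ∧ S b)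

  pairIn-ordered : ∀ S p → T (pairIn S p) → T (ordered p)
  pairIn-ordered S (a , b) h with ordered (a , b)
  ... | true = _

  pairIn⁻ : ∀ S {p a b} → Joins p a b → T (pairIn S p) → T (S a) × T (S b)
  pairIn⁻ S {a = a} {b} (inj₁ refl) h with ordered (a , b) | S a | S b
  ... | true | true | true = _ , _
  pairIn⁻ S {a = a} {b} (inj₂ refl) h with ordered (b , a) | S a | S b
  ... | true | true | true = _ , _

  pairIn⁺ : ∀ S {p a b} → Joins p a b → T (ordered p) → T (S a) → T (S b) → T (pairIn S p)
  pairIn⁺ S {a = a} {b} (inj₁ refl) o a∈S b∈S with ordered (a , b) | S a | S b
  ... | true | true | true = _
  pairIn⁺ S {a = a} {b} (inj₂ refl) o a∈S b∈S with ordered (b , a) | S a | S b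
  ... | true | true | true = _

  pairIn-remove : ∀ S w p → (pairIn S p ∧ not (incident w p)) ≡ pairIn (S - w) p
  pairIn-remove S w (a , b) rewrite ==-sym w a | ==-sym w b =
    shuffle (ordered (a , b)) (S a) (S b) (a == w) (b == w)
    where
    shuffle : ∀ o x y u v → ((o ∧ (x ∧ y)) ∧ not (u ∨ v)) ≡ (o ∧ ((x ∧ not u) ∧ (y ∧ not v)))
    shuffle false _     _     _     _     = refl
    shuffle true  false _     _     _     = refl
    shuffle true  true  false false _     = refl
    shuffle true  true  false true  _     = refl
    shuffle true  true  true  false false = refl
    shuffle true  true  true  false true  = refl
    shuffle true  true  true  true  _     = refl

  pairIn-remove-⊆ : ∀ S w p → T (pairIn (S - w) p) → T (pairIn S p)
  pairIn-remove-⊆ S w p h = proj₁ (Equivalence.to T-∧ (subst T (sym (pairIn-remove S w p)) h))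

  pairsIn : VertexSet → ℕ
  pairsIn S = count (pairIn S) pairs

  pairsAt : VertexSet → V → ℕ
  pairsAt S w = count (λ p → pairIn S p ∧ incident w p) pairs

  pairsIn-remove : ∀ S w → pairsIn S ≡ pairsIn (S - w) + pairsAt S w
  pairsIn-remove S w = begin
    pairsIn S                                                          ≡⟨ count-split pairs (pairIn S) (incident w) ⟩
    pairsAt S w + count (λ p → pairIn S p ∧ not (incident w p)) pairs  ≡⟨ ℕₚ.+-comm (pairsAt S w) _ ⟩
    count (λ p → pairIn S p ∧ not (incident w p)) pairs + pairsAt S w
      ≡⟨ cong (_+ pairsAt S w) (count-cong pairs (pairIn-remove S w)) ⟩
    pairsIn (S - w) + pairsAt S w                                      ∎
    where open ≡-Reasoning

  -- A pair of S at w is determined by its other endpoint, which ranges over S - w.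
  pairsAt-size : ∀ S {w} → T (S w) → pairsAt S w ≡ size (S - w)
  pairsAt-size S {w} w∈S = ℕₚ.≤-antisym
    (count-≤-injection pairs! ∈-vertices (other w) at⇒other other-injective)
    (count-≤-injection vertices! ∈-pairs (sortPair w) other⇒at sortPair-injective)
    where
    at⁻ : ∀ {p} → T (pairIn S p ∧ incident w p) → T (pairIn S p) × T (incident w p)
    at⁻ = Equivalence.to T-∧
    other-joins′ : ∀ {p} → T (pairIn S p ∧ incident w p) → Joins p w (other w p) × other w p ≢ w
    other-joins′ {p} h = other-joins p (pairIn-ordered S p (proj₁ (at⁻ h))) (proj₂ (at⁻ h))
    at⇒other : ∀ {p} → T (pairIn S p ∧ incident w p) → T ((S - w) (other w p))
    at⇒other {p} h = let (joins , o≢w) = other-joins′ h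
                     in ∈-remove⁺ S (proj₂ (pairIn⁻ S joins (proj₁ (at⁻ h)))) o≢w
    other-injective : ∀ {p q} → T (pairIn S p ∧ incident w p) → T (pairIn S q ∧ incident w q) →
                      other w p ≡ other w q → p ≡ q
    other-injective {p} {q} hp hq o≡o =
      joins-unique (pairIn-ordered S p (proj₁ (at⁻ hp))) (pairIn-ordered S q (proj₁ (at⁻ hq)))
        (proj₁ (other-joins′ hp)) (subst (Joins q w) (sym o≡o) (proj₁ (other-joins′ hq)))
    other⇒at : ∀ {x} → T ((S - w) x) → T (pairIn S (sortPair w x) ∧ incident w (sortPair w x))
    other⇒at {x} h = let (x∈S , x≢w) = ∈-remove⁻ S h in
      Equivalence.from T-∧
        ( pairIn⁺ S (sortPair-joins w x) (sortPair-ordered (x≢w ∘ sym)) w∈S x∈S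
        , joins-incident (sortPair-joins w x))
    sortPair-injective : ∀ {x x′} → T ((S - w) x) → T ((S - w) x′) → sortPair w x ≡ sortPair w x′ → x ≡ x′
    sortPair-injective {x} {x′} h _ eq =
      joins-injective (proj₂ (∈-remove⁻ S h)) (sortPair-joins w x)
        (subst (λ p → Joins p w x′) (sym eq) (sortPair-joins w x′))

  pairsIn-size : ∀ m S → size S ≡ m → pairsIn S ≡ m C 2
  pairsIn-size zero S empty = count-none pairs no-pair
    where
    no-pair : ∀ p → ¬ T (pairIn S p)
    no-pair (a , b) h = ℕₚ.<-irrefl (sym empty) (count≥1 (∈-vertices a) (proj₁ (pairIn⁻ S {b = b} (inj₁ refl) h)))
  pairsIn-size (suc m) S size≡1+m with count-∃ vertices (ℕₚ.≤-trans (s≤s z≤n) (ℕₚ.≤-reflexive (sym size≡1+m)))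
  ... | w , _ , w∈S = begin
    pairsIn S                     ≡⟨ pairsIn-remove S w ⟩
    pairsIn (S - w) + pairsAt S w ≡⟨ cong₂ _+_ (pairsIn-size m (S - w) size-1) (trans (pairsAt-size S w∈S) size-1) ⟩
    m C 2 + m                     ≡⟨ ℕₚ.+-comm (m C 2) m ⟩
    m + m C 2                     ≡⟨ cong (_+ m C 2) (sym (nC1≡n m)) ⟩
    m C 1 + m C 2                 ≡⟨ nCk+nC[k+1]≡[n+1]C[k+1] m 1 ⟩
    suc m C 2                     ∎
    where
    open ≡-Reasoning
    size-1 : size (S - w) ≡ m
    size-1 = ℕₚ.suc-injective (trans (sym (size-remove S w∈S)) size≡1+m)

  pick-distinct : ∀ k S → k ≤ size S →
                  Σ (Fin k → V) λ f → (∀ i → T (S (f i))) × Injective _≡_ _≡_ f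
  pick-distinct zero    S _ = (λ ()) , (λ ()) , λ { {()} }
  pick-distinct (suc k) S k<size with count-∃ vertices (ℕₚ.≤-trans (s≤s z≤n) k<size)
  ... | x , _ , x∈S with pick-distinct k (S - x) (ℕₚ.≤-pred (subst (suc k ≤_) (size-remove S x∈S) k<size))
  ...   | g , g∈S-x , g-injective = f , ∈S , injective
    where
    f : Fin (suc k) → V
    f zero    = x
    f (suc i) = g i
    ∈S : ∀ i → T (S (f i))
    ∈S zero    = x∈S
    ∈S (suc i) = proj₁ (∈-remove⁻ S (g∈S-x i))
    injective : Injective _≡_ _≡_ f
    injective {zero}  {zero}  _   = refl
    injective {zero}  {suc j} x≡g = ⊥-elim (proj₂ (∈-remove⁻ S (g∈S-x j)) (sym x≡g))
    injective {suc i} {zero}  g≡x = ⊥-elim (proj₂ (∈-remove⁻ S (g∈S-x i)) g≡x)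
    injective {suc i} {suc j} g≡g = cong suc (g-injective g≡g)

  count-pairIn-remove : ∀ S w (Q : Pair → Bool) →
    count (λ p → pairIn S p ∧ Q p) pairs ≡
    count (λ p → pairIn (S - w) p ∧ Q p) pairs + count (λ p → (pairIn S p ∧ Q p) ∧ incident w p) pairs
  count-pairIn-remove S w Q = begin
    count (λ p → pairIn S p ∧ Q p) pairs                   ≡⟨ count-split pairs _ (incident w) ⟩
    at + count (λ p → (pairIn S p ∧ Q p) ∧ not (incident w p)) pairs ≡⟨ cong (at +_) (count-cong pairs away) ⟩
    at + count (λ p → pairIn (S - w) p ∧ Q p) pairs        ≡⟨ ℕₚ.+-comm at _ ⟩
    count (λ p → pairIn (S - w) p ∧ Q p) pairs + at        ∎
    where
    open ≡-Reasoning
    at : ℕ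
    at = count (λ p → (pairIn S p ∧ Q p) ∧ incident w p) pairs
    away : ∀ p → ((pairIn S p ∧ Q p) ∧ not (incident w p)) ≡ (pairIn (S - w) p ∧ Q p)
    away p = trans (∧-swapʳ (pairIn S p) (Q p) _) (cong (_∧ Q p) (pairIn-remove S w p))

  count-pairsAt-split : ∀ S w (Q : Pair → Bool) →
    pairsAt S w ≡ count (λ p → (pairIn S p ∧ Q p) ∧ incident w p) pairs
                + count (λ p → (pairIn S p ∧ not (Q p)) ∧ incident w p) pairs
  count-pairsAt-split S w Q = trans (count-split pairs _ Q)
    (cong₂ _+_ (count-cong pairs (λ p → ∧-swapʳ (pairIn S p) (incident w p) (Q p)))
               (count-cong pairs (λ p → ∧-swapʳ (pairIn S p) (incident w p) (not (Q p)))))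

  incident-count : ∀ p → count (λ w → incident w p) vertices ≤ 2
  incident-count (a , b) = ℕₚ.≤-trans (count-∨ vertices (_== a) (_== b))
    (ℕₚ.≤-reflexive (cong₂ _+_ (count-≟ F._≟_ vertices! (∈-vertices a)) (count-≟ F._≟_ vertices! (∈-vertices b))))

  common-incident-count : ∀ {p q} → T (ordered p) → T (ordered q) → p ≢ q →
                          count (λ w → incident w p ∧ incident w q) vertices ≤ 1
  common-incident-count {p} {q} o-p o-q p≢q = ℕₚ.≮⇒≥ λ two →
    let (x , y , x≢y , x∈p∧q , y∈p∧q) = distinct-witnesses vertices! two
        (x∈p , x∈q) = Equivalence.to T-∧ x∈p∧q
        (y∈p , y∈q) = Equivalence.to T-∧ y∈p∧q
    in p≢q (joins-unique o-p o-q (incident-both p x≢y x∈p y∈p) (incident-both q x≢y x∈q y∈q))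

module Coloring {n : ℕ} (G : ColoredGraph n) where
  open Vertices n
  open ColoredGraph G renaming (sym to Adj-sym)

  adjacent : Pair → Bool
  adjacent (a , b) = ⌊ adj? a b ⌋

  pairColor : Pair → ℕ
  pairColor (a , b) = color a b

  edgeIn : VertexSet → Pair → Bool
  edgeIn S p = pairIn S p ∧ adjacent p

  nonEdgeIn : VertexSet → Pair → Bool
  nonEdgeIn S p = pairIn S p ∧ not (adjacent p)

  edges : VertexSet → ℕ
  edges S = count (edgeIn S) pairs

  nonEdges : VertexSet → ℕ
  nonEdges S = count (nonEdgeIn S) pairs

  degree : VertexSet → V → ℕ
  degree S w = count (λ p → edgeIn S p ∧ incident w p) pairs

  nonDegree : VertexSet → V → ℕ
  nonDegree S w = count (λ p → nonEdgeIn S p ∧ incident w p) pairs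

  edges+nonEdges : ∀ S → edges S + nonEdges S ≡ pairsIn S
  edges+nonEdges S = sym (count-split pairs (pairIn S) adjacent)

  degree+nonDegree : ∀ S w → degree S w + nonDegree S w ≡ pairsAt S w
  degree+nonDegree S w = sym (count-pairsAt-split S w adjacent)

  edges-remove : ∀ S w → edges S ≡ edges (S - w) + degree S w
  edges-remove S w = count-pairIn-remove S w adjacent

  nonEdges-remove : ∀ S w → nonEdges S ≡ nonEdges (S - w) + nonDegree S w
  nonEdges-remove S w = count-pairIn-remove S w (not ∘ adjacent)

  edgeIn⁻ : ∀ S p → T (edgeIn S p) → T (pairIn S p) × T (adjacent p)
  edgeIn⁻ S p = Equivalence.to (T-∧ {pairIn S p})

  edgeIn-remove-⊆ : ∀ S w p → T (edgeIn (S - w) p) → T (edgeIn S p)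
  edgeIn-remove-⊆ S w p h = let (p∈S-w , adj) = edgeIn⁻ (S - w) p h in
    Equivalence.from T-∧ (pairIn-remove-⊆ S w p p∈S-w , adj)

  edgeIn-remove : ∀ S w p → T (edgeIn S p) → ¬ T (incident w p) → T (edgeIn (S - w) p)
  edgeIn-remove S w p h w∉p = let (p∈S , adj) = edgeIn⁻ S p h in
    Equivalence.from T-∧ (subst T (pairIn-remove S w p) (Equivalence.from T-∧ (p∈S , ¬T⇒T-not (incident w p) w∉p)) , adj)

  hasColor : VertexSet → ℕ → Pair → Bool
  hasColor S k p = edgeIn S p ∧ (pairColor p ≡ᵇ k)

  hasColor⁻ : ∀ S k p → T (hasColor S k p) → T (edgeIn S p) × pairColor p ≡ k
  hasColor⁻ S k p h = let (e , c) = Equivalence.to (T-∧ {edgeIn S p}) h in e , ℕₚ.≡ᵇ⇒≡ _ _ c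

  hasColor⁺ : ∀ S {k} p → T (edgeIn S p) → pairColor p ≡ k → T (hasColor S k p)
  hasColor⁺ S p e refl = Equivalence.from T-∧ (e , ℕₚ.≡⇒≡ᵇ (pairColor p) _ refl)

  firstOfColor : VertexSet → ℕ → Maybe Pair
  firstOfColor S k = findᵇ (hasColor S k) pairs

  -- Colors are counted through representatives: the first edge of each color class in pairs.
  isRep : VertexSet → Pair → Bool
  isRep S p = ⌊ Maybe.≡-dec _≟ᵖ_ (firstOfColor S (pairColor p)) (just p) ⌋

  colors : VertexSet → ℕ
  colors S = count (isRep S) pairs

  firstOfColor-isRep : ∀ S {k p} → firstOfColor S k ≡ just p → T (isRep S p) × pairColor p ≡ k
  firstOfColor-isRep S {k} {p} first with proj₂ (hasColor⁻ S k p (findᵇ-sound (hasColor S k) pairs first))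
  ... | refl = fromWitness first , refl

  isRep⇒edgeIn : ∀ S p → T (isRep S p) → T (edgeIn S p)
  isRep⇒edgeIn S p rep = proj₁ (hasColor⁻ S _ p (findᵇ-sound (hasColor S (pairColor p)) pairs (toWitness rep)))

  isRep-unique : ∀ S {p q} → T (isRep S p) → T (isRep S q) → pairColor p ≡ pairColor q → p ≡ q
  isRep-unique S {p} {q} rep-p rep-q same =
    just-injective (trans (sym (toWitness rep-p)) (trans (cong (firstOfColor S) same) (toWitness rep-q)))

  representative : ∀ S {k q} → T (hasColor S k q) → ∃ λ p → firstOfColor S k ≡ just p
  representative S {k} {q} h = findᵇ-complete (hasColor S k) (∈-pairs q) h

  colors≤edges : ∀ S → colors S ≤ edges S
  colors≤edges S = count-mono pairs (isRep⇒edgeIn S _)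

  nonReps : VertexSet → ℕ
  nonReps S = count (λ p → edgeIn S p ∧ not (isRep S p)) pairs

  edges≡colors+nonReps : ∀ S → edges S ≡ colors S + nonReps S
  edges≡colors+nonReps S =
    trans (count-split pairs (edgeIn S) (isRep S)) (cong (_+ nonReps S) (count-cong pairs edge∧rep))
    where
    edge∧rep : ∀ p → (edgeIn S p ∧ isRep S p) ≡ isRep S p
    edge∧rep p with isRep S p in rep
    ... | true  = trans (∧-identityʳ _) (Equivalence.to T-≡ (isRep⇒edgeIn S p (subst T (sym rep) _)))
    ... | false = ∧-zeroʳ _

  nonRep⁻ : ∀ S p → T (edgeIn S p ∧ not (isRep S p)) → T (edgeIn S p) × ¬ T (isRep S p)
  nonRep⁻ S p h = let (e , r) = Equivalence.to (T-∧ {edgeIn S p}) h in e , T-not⇒¬T (isRep S p) r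

  Rainbow : VertexSet → Set
  Rainbow S = ∀ {p q} → T (edgeIn S p) → T (edgeIn S q) → pairColor p ≡ pairColor q → p ≡ q

  colors≡edges⇒Rainbow : ∀ S → colors S ≡ edges S → Rainbow S
  colors≡edges⇒Rainbow S c≡e {p} {q} e-p e-q = isRep-unique S (all-reps e-p) (all-reps e-q)
    where
    all-reps : ∀ {r} → T (edgeIn S r) → T (isRep S r)
    all-reps {r} e-r with isRep S r in rep
    ... | true  = _
    ... | false = ℕₚ.<-irrefl c≡e (begin-strict
      colors S                ≡⟨ sym (ℕₚ.+-identityʳ _) ⟩
      colors S + 0            <⟨ ℕₚ.+-monoʳ-< (colors S) (count≥1 (∈-pairs r) edge∧nonRep) ⟩
      colors S + nonReps S    ≡⟨ sym (edges≡colors+nonReps S) ⟩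
      edges S                 ∎)
      where
      open ℕₚ.≤-Reasoning
      edge∧nonRep : T (edgeIn S r ∧ not (isRep S r))
      edge∧nonRep = Equivalence.from T-∧ (e-r , subst (T ∘ not) (sym rep) _)

  Rainbow-remove : ∀ S w → Rainbow S → Rainbow (S - w)
  Rainbow-remove S w rainbow {p} {q} e-p e-q = rainbow (edgeIn-remove-⊆ S w p e-p) (edgeIn-remove-⊆ S w q e-q)

  escapes : VertexSet → V → ℕ → Bool
  escapes S w k = any (λ q → hasColor S k q ∧ not (incident w q)) pairs

  escapes⁻ : ∀ S w k → T (escapes S w k) → ∃ λ q → T (hasColor S k q) × ¬ T (incident w q)
  escapes⁻ S w k h with satisfied (any⁻ _ pairs h)
  ... | q , escaping = let (c , w∉q) = Equivalence.to (T-∧ {hasColor S k q}) escaping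
                       in q , c , T-not⇒¬T (incident w q) w∉q

  owns : VertexSet → V → ℕ → Bool
  owns S w k = not (escapes S w k)

  owns⇒incident : ∀ S w {k q} → T (owns S w k) → T (hasColor S k q) → T (incident w q)
  owns⇒incident S w {k} {q} own c with incident w q in w∈q
  ... | true  = _
  ... | false = T-not⇒¬T (escapes S w k) own
                  (any⁺ _ (lose (∈-pairs q) (Equivalence.from T-∧ (c , subst (T ∘ not) (sym w∈q) _))))

  owners : VertexSet → Pair → ℕ
  owners S p = count (λ w → S w ∧ owns S w (pairColor p)) vertices

  ownedColors : VertexSet → V → ℕ
  ownedColors S w = count (λ p → isRep S p ∧ owns S w (pairColor p)) pairs

  repeated : VertexSet → Pair → Bool
  repeated S p = any (λ q → hasColor S (pairColor p) q ∧ not ⌊ q ≟ᵖ p ⌋) pairs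

  repeated⁺ : ∀ S {p q} → T (hasColor S (pairColor p) q) → q ≢ p → T (repeated S p)
  repeated⁺ S {p} {q} c q≢p =
    any⁺ _ (lose (∈-pairs q) (Equivalence.from T-∧ (c , ¬T⇒T-not ⌊ q ≟ᵖ p ⌋ (q≢p ∘ toWitness))))

  repeated⁻ : ∀ S p → T (repeated S p) → ∃ λ q → T (hasColor S (pairColor p) q) × q ≢ p
  repeated⁻ S p h with satisfied (any⁻ _ pairs h)
  ... | q , other = let (c , q≢p) = Equivalence.to (T-∧ {hasColor S (pairColor p) q}) other
                    in q , c , T-not⇒¬T ⌊ q ≟ᵖ p ⌋ q≢p ∘ fromWitness

  repeatedColors : VertexSet → ℕ
  repeatedColors S = count (λ p → isRep S p ∧ repeated S p) pairs

  unownedRepeatedColors : VertexSet → ℕ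
  unownedRepeatedColors S = count (λ p → isRep S p ∧ (repeated S p ∧ (owners S p ≡ᵇ 0))) pairs

  -- A color class that reaches S - w has a representative there; this maps colors injectively.
  colors-remove : ∀ S w → colors S ≤ colors (S - w) + ownedColors S w
  colors-remove S w = begin
    colors S
      ≡⟨ count-split pairs (isRep S) (escapes S w ∘ pairColor) ⟩
    count (λ p → isRep S p ∧ escapes S w (pairColor p)) pairs + ownedColors S w
      ≤⟨ ℕₚ.+-monoˡ-≤ (ownedColors S w)
           (count-≤-injection pairs! ∈-pairs repAfter (proj₁ ∘ image) repAfter-injective) ⟩
    colors (S - w) + ownedColors S w ∎
    where
    open ℕₚ.≤-Reasoning
    repAfter : Pair → Pair
    repAfter p = fromMaybe p (firstOfColor (S - w) (pairColor p))
    image : ∀ {p} → T (isRep S p ∧ escapes S w (pairColor p)) →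
            T (isRep (S - w) (repAfter p)) × pairColor (repAfter p) ≡ pairColor p
    image {p} h with escapes⁻ S w (pairColor p) (proj₂ (Equivalence.to (T-∧ {isRep S p}) h))
    ... | q , c , w∉q with hasColor⁻ S _ q c
    ...   | e-q , color-q with representative (S - w) (hasColor⁺ (S - w) q (edgeIn-remove S w q e-q w∉q) color-q)
    ...     | y , first = subst (λ r → T (isRep (S - w) r) × pairColor r ≡ pairColor p)
                                (sym (cong (fromMaybe p) first)) (firstOfColor-isRep (S - w) first)
    repAfter-injective : ∀ {p p′} → T (isRep S p ∧ escapes S w (pairColor p)) →
                         T (isRep S p′ ∧ escapes S w (pairColor p′)) → repAfter p ≡ repAfter p′ → p ≡ p′
    repAfter-injective {p} {p′} h h′ same = isRep-unique S
      (proj₁ (Equivalence.to (T-∧ {isRep S p}) h)) (proj₁ (Equivalence.to (T-∧ {isRep S p′}) h′))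
      (trans (sym (proj₂ (image h))) (trans (cong pairColor same) (proj₂ (image h′))))

  owners≤2 : ∀ S p → T (isRep S p) → owners S p ≤ 2
  owners≤2 S p rep = ℕₚ.≤-trans (count-mono vertices on-p) (incident-count p)
    where
    on-p : ∀ {w} → T (S w ∧ owns S w (pairColor p)) → T (incident w p)
    on-p {w} h = owns⇒incident S w (proj₂ (Equivalence.to (T-∧ {S w}) h)) (hasColor⁺ S p (isRep⇒edgeIn S p rep) refl)

  owners≤1 : ∀ S p → T (isRep S p) → T (repeated S p) → owners S p ≤ 1
  owners≤1 S p rep rpt with repeated⁻ S p rpt
  ... | q , c , q≢p = ℕₚ.≤-trans (count-mono vertices on-p-and-q)
                        (common-incident-count (ordered-of p e-p) (ordered-of q e-q) (q≢p ∘ sym))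
    where
    e-p : T (edgeIn S p)
    e-p = isRep⇒edgeIn S p rep
    e-q : T (edgeIn S q)
    e-q = proj₁ (hasColor⁻ S _ q c)
    ordered-of : ∀ r → T (edgeIn S r) → T (ordered r)
    ordered-of r e-r = pairIn-ordered S r (proj₁ (edgeIn⁻ S r e-r))
    on-p-and-q : ∀ {w} → T (S w ∧ owns S w (pairColor p)) → T (incident w p ∧ incident w q)
    on-p-and-q {w} h = let own = proj₂ (Equivalence.to (T-∧ {S w}) h) in
      Equivalence.from (T-∧ {incident w p}) (owns⇒incident S w own (hasColor⁺ S p e-p refl) , owns⇒incident S w own c)

  ∑-ownedColors : ∀ S → ∑[ w ← vertices ] (𝟙 (S w) * ownedColors S w) ≡ ∑[ p ← pairs ] (𝟙 (isRep S p) * owners S p)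
  ∑-ownedColors S = begin
    ∑[ w ← vertices ] (𝟙 (S w) * ownedColors S w)
      ≡⟨ ∑-cong vertices (λ w → *-distribˡ-∑ (𝟙 (S w)) pairs _) ⟩
    ∑[ w ← vertices ] ∑[ p ← pairs ] (𝟙 (S w) * 𝟙 (isRep S p ∧ owns S w (pairColor p)))
      ≡⟨ ∑-comm vertices pairs _ ⟩
    ∑[ p ← pairs ] ∑[ w ← vertices ] (𝟙 (S w) * 𝟙 (isRep S p ∧ owns S w (pairColor p)))
      ≡⟨ ∑-cong pairs (λ p → trans (∑-cong vertices (λ w → swap (S w) (isRep S p) _))
                                   (sym (*-distribˡ-∑ (𝟙 (isRep S p)) vertices _))) ⟩
    ∑[ p ← pairs ] (𝟙 (isRep S p) * owners S p) ∎
    where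
    open ≡-Reasoning
    swap : ∀ s r o → 𝟙 s * 𝟙 (r ∧ o) ≡ 𝟙 r * 𝟙 (s ∧ o)
    swap false r     o = sym (ℕₚ.*-zeroʳ (𝟙 r))
    swap true  false o = refl
    swap true  true  o = refl

  -- Per color, owners + [repeated] + [repeated and unowned] ≤ 2: an owner lies on every edge
  -- of the color, so a repeated color has at most one.
  ownership-bound : ∀ S → ∑[ w ← vertices ] (𝟙 (S w) * ownedColors S w) + repeatedColors S + unownedRepeatedColors S
                          ≤ 2 * colors S
  ownership-bound S = begin
    ∑[ w ← vertices ] (𝟙 (S w) * ownedColors S w) + repeatedColors S + unownedRepeatedColors S
      ≡⟨ cong (λ x → x + repeatedColors S + unownedRepeatedColors S) (∑-ownedColors S) ⟩
    ∑[ p ← pairs ] (𝟙 (isRep S p) * owners S p) + repeatedColors S + unownedRepeatedColors S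
      ≡⟨ sym (trans (∑-distrib-+ pairs _ _) (cong (_+ unownedRepeatedColors S) (∑-distrib-+ pairs _ _))) ⟩
    ∑[ p ← pairs ] (𝟙 (isRep S p) * owners S p + 𝟙 (isRep S p ∧ repeated S p)
                    + 𝟙 (isRep S p ∧ (repeated S p ∧ (owners S p ≡ᵇ 0))))
      ≤⟨ ∑-mono-≤ pairs per-pair ⟩
    ∑[ p ← pairs ] (2 * 𝟙 (isRep S p))
      ≡⟨ sym (*-distribˡ-∑ 2 pairs _) ⟩
    2 * colors S ∎
    where
    open ℕₚ.≤-Reasoning
    slots : ∀ m b → m ≤ 2 → (T b → m ≤ 1) → m + 𝟙 b + 𝟙 (b ∧ (m ≡ᵇ 0)) ≤ 2
    slots m             false m≤2 _   = subst (_≤ 2) (sym (trans (ℕₚ.+-identityʳ _) (ℕₚ.+-identityʳ m))) m≤2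
    slots 0             true  _   _   = ℕₚ.≤-refl
    slots 1             true  _   _   = ℕₚ.≤-refl
    slots (suc (suc m)) true  _   m≤1 = ⊥-elim (ℕₚ.<-irrefl refl (ℕₚ.≤-trans (m≤1 _) (s≤s z≤n)))
    per-pair : ∀ p → 𝟙 (isRep S p) * owners S p + 𝟙 (isRep S p ∧ repeated S p)
                     + 𝟙 (isRep S p ∧ (repeated S p ∧ (owners S p ≡ᵇ 0))) ≤ 2 * 𝟙 (isRep S p)
    per-pair p with isRep S p in rep
    ... | false = z≤n
    ... | true  = subst (λ x → x + 𝟙 (repeated S p) + 𝟙 (repeated S p ∧ (owners S p ≡ᵇ 0)) ≤ 2)
                        (sym (ℕₚ.*-identityˡ (owners S p)))
                    (slots (owners S p) (repeated S p) (owners≤2 S p rep′) (owners≤1 S p rep′))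
      where
      rep′ : T (isRep S p)
      rep′ = subst T (sym rep) _

  weight : VertexSet → ℕ
  weight S = edges S + colors S + nonEdges S ⊓ 1

  WeightBound : ℕ → ℕ → Set
  WeightBound m B = ∀ S → size S ≡ m → weight S ≤ B

  weight-remove : ∀ S {w m} → T (S w) → size S ≡ suc m → weight S ≤ ownedColors S w + weight (S - w) + m
  weight-remove S {w} {m} w∈S size≡1+m = begin
    edges S + colors S + nonEdges S ⊓ 1
      ≤⟨ ℕₚ.+-mono-≤ (ℕₚ.+-mono-≤ (ℕₚ.≤-reflexive (edges-remove S w)) (colors-remove S w)) incomplete-remove ⟩
    (edges (S - w) + degree S w) + (colors (S - w) + ownedColors S w) + (nonEdges (S - w) ⊓ 1 + nonDegree S w)
      ≡⟨ rearrange (edges (S - w)) (degree S w) (colors (S - w)) (ownedColors S w) (nonEdges (S - w) ⊓ 1) (nonDegree S w) ⟩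
    ownedColors S w + weight (S - w) + (degree S w + nonDegree S w)
      ≡⟨ cong (ownedColors S w + weight (S - w) +_) (trans (degree+nonDegree S w) (pairsAt-size S w∈S)) ⟩
    ownedColors S w + weight (S - w) + size (S - w)
      ≡⟨ cong (ownedColors S w + weight (S - w) +_) (ℕₚ.suc-injective (trans (sym (size-remove S w∈S)) size≡1+m)) ⟩
    ownedColors S w + weight (S - w) + m ∎
    where
    open ℕₚ.≤-Reasoning
    incomplete-remove : nonEdges S ⊓ 1 ≤ nonEdges (S - w) ⊓ 1 + nonDegree S w
    incomplete-remove = subst (λ x → x ⊓ 1 ≤ nonEdges (S - w) ⊓ 1 + nonDegree S w) (sym (nonEdges-remove S w))
                              (+-⊓1 (nonEdges (S - w)) (nonDegree S w))
    rearrange : ∀ e d c o x y → (e + d) + (c + o) + (x + y) ≡ o + (e + c + x) + (d + y)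
    rearrange = solve-∀

  weight-bound-at : ∀ {m B} → WeightBound m B → ∀ S {w} → T (S w) → size S ≡ suc m →
                    weight S ≤ ownedColors S w + (B + m)
  weight-bound-at {m} {B} bound S {w} w∈S size≡1+m = begin
    weight S                                  ≤⟨ weight-remove S w∈S size≡1+m ⟩
    ownedColors S w + weight (S - w) + m
      ≤⟨ ℕₚ.+-monoˡ-≤ m (ℕₚ.+-monoʳ-≤ (ownedColors S w) (bound (S - w) size-1)) ⟩
    ownedColors S w + B + m                   ≡⟨ ℕₚ.+-assoc (ownedColors S w) B m ⟩
    ownedColors S w + (B + m)                 ∎
    where
    open ℕₚ.≤-Reasoning
    size-1 : size (S - w) ≡ m
    size-1 = ℕₚ.suc-injective (trans (sym (size-remove S w∈S)) size≡1+m)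

  ∑-indicator : ∀ S c → ∑[ w ← vertices ] (𝟙 (S w) * c) ≡ size S * c
  ∑-indicator S c = begin
    ∑[ w ← vertices ] (𝟙 (S w) * c) ≡⟨ ∑-cong vertices (λ w → ℕₚ.*-comm (𝟙 (S w)) c) ⟩
    ∑[ w ← vertices ] (c * 𝟙 (S w)) ≡⟨ sym (*-distribˡ-∑ c vertices _) ⟩
    c * size S                      ≡⟨ ℕₚ.*-comm c (size S) ⟩
    size S * c                      ∎
    where open ≡-Reasoning

  ∑-indicator-mono : ∀ (S : VertexSet) {f g : V → ℕ} → (∀ w → T (S w) → f w ≤ g w) →
                     ∑[ w ← vertices ] (𝟙 (S w) * f w) ≤ ∑[ w ← vertices ] (𝟙 (S w) * g w)
  ∑-indicator-mono S {f} {g} f≤g = ∑-mono-≤ vertices pointwise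
    where
    pointwise : ∀ w → 𝟙 (S w) * f w ≤ 𝟙 (S w) * g w
    pointwise w with S w in w∈S
    ... | false = z≤n
    ... | true  = ℕₚ.+-monoˡ-≤ 0 (f≤g w (subst T (sym w∈S) _))

  averaging : ∀ {m B} → WeightBound m B → ∀ S → size S ≡ suc m →
              suc m * weight S + repeatedColors S + unownedRepeatedColors S ≤ 2 * colors S + suc m * (B + m)
  averaging {m} {B} bound S size≡1+m = begin
    suc m * weight S + t + u
      ≡⟨ cong (λ x → x * weight S + t + u) (sym size≡1+m) ⟩
    size S * weight S + t + u
      ≡⟨ cong (λ x → x + t + u) (sym (∑-indicator S (weight S))) ⟩
    ∑[ w ← vertices ] (𝟙 (S w) * weight S) + t + u
      ≤⟨ ℕₚ.+-monoˡ-≤ u (ℕₚ.+-monoˡ-≤ t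
           (∑-indicator-mono S (λ w w∈S → weight-bound-at bound S w∈S size≡1+m))) ⟩
    ∑[ w ← vertices ] (𝟙 (S w) * (ownedColors S w + (B + m))) + t + u
      ≡⟨ cong (λ x → x + t + u) (trans (∑-cong vertices (λ w → ℕₚ.*-distribˡ-+ (𝟙 (S w)) (ownedColors S w) (B + m)))
                                       (∑-distrib-+ vertices _ _)) ⟩
    ∑[ w ← vertices ] (𝟙 (S w) * ownedColors S w) + ∑[ w ← vertices ] (𝟙 (S w) * (B + m)) + t + u
      ≡⟨ cong (λ x → ∑[ w ← vertices ] (𝟙 (S w) * ownedColors S w) + x + t + u)
              (trans (∑-indicator S (B + m)) (cong (_* (B + m)) size≡1+m)) ⟩
    ∑[ w ← vertices ] (𝟙 (S w) * ownedColors S w) + suc m * (B + m) + t + u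
      ≡⟨ rearrange (∑[ w ← vertices ] (𝟙 (S w) * ownedColors S w)) (suc m * (B + m)) t u ⟩
    ∑[ w ← vertices ] (𝟙 (S w) * ownedColors S w) + t + u + suc m * (B + m)
      ≤⟨ ℕₚ.+-monoˡ-≤ (suc m * (B + m)) (ownership-bound S) ⟩
    2 * colors S + suc m * (B + m) ∎
    where
    open ℕₚ.≤-Reasoning
    t u : ℕ
    t = repeatedColors S
    u = unownedRepeatedColors S
    rearrange : ∀ a b c d → a + b + c + d ≡ a + c + d + b
    rearrange = solve-∀

  nonRep⇒repeated : ∀ S {q} → T (edgeIn S q) → ¬ T (isRep S q) →
                    ∃ λ p → T (isRep S p) × T (repeated S p) × pairColor p ≡ pairColor q
  nonRep⇒repeated S {q} e-q ¬rep with representative S (hasColor⁺ S q e-q refl)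
  ... | p , first with firstOfColor-isRep S first
  ...   | rep , same = p , rep , repeated⁺ S (hasColor⁺ S q e-q (sym same)) q≢p , same
    where
    q≢p : q ≢ p
    q≢p q≡p = ¬rep (subst (T ∘ isRep S) (sym q≡p) rep)

  repeatedColors-pos : ∀ S → colors S < edges S → 1 ≤ repeatedColors S
  repeatedColors-pos S c<e with count-∃ pairs (ℕₚ.+-cancelˡ-≤ (colors S) 1 (nonReps S)
    (subst (colors S + 1 ≤_) (edges≡colors+nonReps S) (subst (_≤ edges S) (ℕₚ.+-comm 1 (colors S)) c<e)))
  ... | q , _ , nonRep with nonRep⁻ S q nonRep
  ...   | e-q , ¬rep with nonRep⇒repeated S e-q ¬rep
  ...     | p , rep , rpt , _ = count≥1 (∈-pairs p) (Equivalence.from T-∧ (rep , rpt))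

  Adj-joins : ∀ {p a b} → Joins p a b → T (adjacent p) → Adj a b
  Adj-joins (inj₁ refl) adj = toWitness adj
  Adj-joins (inj₂ refl) adj = Adj-sym (toWitness adj)

  pairColor-joins : ∀ {p a b} → Joins p a b → pairColor p ≡ color a b
  pairColor-joins             (inj₁ refl) = refl
  pairColor-joins {a = a} {b} (inj₂ refl) = colSym b a

  nonEdges≡0⇒adjacent : ∀ S {p} → nonEdges S ≡ 0 → T (pairIn S p) → T (adjacent p)
  nonEdges≡0⇒adjacent S {p} none p∈S with adjacent p in adj
  ... | true  = _
  ... | false = ℕₚ.<-irrefl (sym none)
                  (count≥1 (∈-pairs p) (Equivalence.from T-∧ (p∈S , subst (T ∘ not) (sym adj) _)))

  clique-rainbowK : ∀ {k} S → Rainbow S → nonEdges S ≡ 0 → k ≤ size S → RainbowK G k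
  clique-rainbowK {k} S rainbow none k≤size = build (pick-distinct k S k≤size)
    where
    build : (Σ (Fin k → V) λ f → (∀ i → T (S (f i))) × Injective _≡_ _≡_ f) → RainbowK G k
    build (f , f∈S , f-injective) = f , distinct , adjacent-f , rainbow-f
      where
      distinct : ∀ i j → i ≢ j → f i ≢ f j
      distinct i j i≢j = i≢j ∘ f-injective
      joins : ∀ i j → Joins (sortPair (f i) (f j)) (f i) (f j)
      joins i j = sortPair-joins (f i) (f j)
      edge : ∀ i j → i ≢ j → T (edgeIn S (sortPair (f i) (f j)))
      edge i j i≢j = Equivalence.from T-∧ (p∈S , nonEdges≡0⇒adjacent S none p∈S)
        where
        p∈S : T (pairIn S (sortPair (f i) (f j)))
        p∈S = pairIn⁺ S (joins i j) (sortPair-ordered (distinct i j i≢j)) (f∈S i) (f∈S j)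
      adjacent-f : ∀ i j → i ≢ j → Adj (f i) (f j)
      adjacent-f i j i≢j = Adj-joins (joins i j) (proj₂ (edgeIn⁻ S _ (edge i j i≢j)))
      same-pair : ∀ {i j i′ j′} → i ≢ j → i′ ≢ j′ → color (f i) (f j) ≡ color (f i′) (f j′) →
                  sortPair (f i) (f j) ≡ sortPair (f i′) (f j′)
      same-pair {i} {j} {i′} {j′} i≢j i′≢j′ same = rainbow (edge i j i≢j) (edge i′ j′ i′≢j′)
        (trans (pairColor-joins (joins i j)) (trans same (sym (pairColor-joins (joins i′ j′)))))
      rainbow-f : ∀ i j i′ j′ → i Fin.< j → i′ Fin.< j′ → (i , j) ≢ (i′ , j′) →
                  color (f i) (f j) ≢ color (f i′) (f j′)
      rainbow-f i j i′ j′ i<j i′<j′ ij≢i′j′ same =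
        endpoints (joins-endpoints (joins i j) (subst (λ r → Joins r (f i′) (f j′)) (sym p≡p′) (joins i′ j′)))
        where
        p≡p′ : sortPair (f i) (f j) ≡ sortPair (f i′) (f j′)
        p≡p′ = same-pair (F.<⇒≢ i<j) (F.<⇒≢ i′<j′) same
        endpoints : (f i ≡ f i′ × f j ≡ f j′) ⊎ (f i ≡ f j′ × f j ≡ f i′) → ⊥
        endpoints (inj₁ (fi≡fi′ , fj≡fj′)) = ij≢i′j′ (cong₂ _,_ (f-injective fi≡fi′) (f-injective fj≡fj′))
        endpoints (inj₂ (fi≡fj′ , fj≡fi′)) = <-crossed i<j i′<j′ (f-injective fi≡fj′) (f-injective fj≡fi′)

  rainbowK : ∀ {k} m S → size S ≡ m → Rainbow S → nonEdges S + k ≤ m → RainbowK G k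
  rainbowK zero S size≡0 rainbow room =
    clique-rainbowK S rainbow (ℕₚ.n≤0⇒n≡0 (ℕₚ.m+n≤o⇒m≤o _ room))
                              (subst (_ ≤_) (sym size≡0) (ℕₚ.m+n≤o⇒n≤o _ room))
  rainbowK (suc m) S size≡ rainbow room with nonEdges S in none
  ... | zero  = clique-rainbowK S rainbow none (subst (_ ≤_) (sym size≡) room)
  ... | suc j with count-∃ pairs (subst (1 ≤_) (sym none) (s≤s z≤n))
  ...   | (a , b) , _ , nonEdge-ab =
    rainbowK m (S - a) size-1 (Rainbow-remove S a rainbow) (ℕₚ.≤-trans (ℕₚ.+-monoˡ-≤ _ fewer) (ℕₚ.≤-pred room))
    where
    ab∈S : T (pairIn S (a , b))
    ab∈S = proj₁ (Equivalence.to (T-∧ {pairIn S (a , b)}) nonEdge-ab)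
    size-1 : size (S - a) ≡ m
    size-1 = ℕₚ.suc-injective (trans (sym (size-remove S (proj₁ (pairIn⁻ S {b = b} (inj₁ refl) ab∈S)))) size≡)
    at-a : 1 ≤ nonDegree S a
    at-a = count≥1 (∈-pairs (a , b))
      (Equivalence.from (T-∧ {nonEdgeIn S (a , b)}) (nonEdge-ab , joins-incident {a = a} {b} (inj₁ refl)))
    fewer : nonEdges (S - a) ≤ j
    fewer = ℕₚ.≤-pred (subst (_≤ suc j) (ℕₚ.+-comm (nonEdges (S - a)) 1)
              (subst (nonEdges (S - a) + 1 ≤_) (trans (sym (nonEdges-remove S a)) none)
                 (ℕₚ.+-monoʳ-≤ (nonEdges (S - a)) at-a)))

  full : VertexSet
  full _ = true

  edges-full : e G ≡ edges full
  edges-full = trans (length-filter _ pairs) (count-cong pairs same)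
    where
    same : ∀ p → (does (proj₁ p F.<? proj₂ p) ∧ does (adj? (proj₁ p) (proj₂ p))) ≡ edgeIn full p
    same (a , b) = sym (cong₂ _∧_ (trans (∧-identityʳ _) (isYes≗does (a F.<? b))) (isYes≗does (adj? a b)))

  colors-full : c G ≤ colors full
  colors-full = begin
    c G                                                 ≤⟨ length-≤-injection (deduplicate-! ℕₚ._≟_ _) id reached (λ _ _ → id) ⟩
    length (map pairColor (filterᵇ (isRep full) pairs)) ≡⟨ length-map pairColor (filterᵇ (isRep full) pairs) ⟩
    length (filterᵇ (isRep full) pairs)                 ≡⟨ length-filter (T? ∘ isRep full) pairs ⟩
    colors full                                         ∎
    where
    open ℕₚ.≤-Reasoning
    reached : ∀ {k} → k ∈ deduplicate ℕₚ._≟_ (map pairColor (edgeList G)) →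
              k ∈ map pairColor (filterᵇ (isRep full) pairs)
    reached k∈ with ∈-map⁻ pairColor (∈-deduplicate⁻ ℕₚ._≟_ (map pairColor (edgeList G)) k∈)
    ... | q , q∈edgeList , refl
      with proj₂ (∈-filter⁻ (λ p → (proj₁ p F.<? proj₂ p) ×-dec adj? (proj₁ p) (proj₂ p)) {xs = pairs} q∈edgeList)
    ...   | q-ordered , q-adj with representative full (hasColor⁺ full q e-q refl)
      where
      e-q : T (edgeIn full q)
      e-q = Equivalence.from (T-∧ {pairIn full q})
              (Equivalence.from (T-∧ {ordered q}) (fromWitness q-ordered , _) , fromWitness q-adj)
    ...     | p , first with firstOfColor-isRep full first
    ...       | rep , same = subst (_∈ map pairColor (filterᵇ (isRep full) pairs)) same
                               (∈-map⁺ pairColor (∈-filter⁺ (T? ∘ isRep full) (∈-pairs p) rep))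

  e+c+incomplete≤weight : e G + c G + nonEdges full ⊓ 1 ≤ weight full
  e+c+incomplete≤weight = ℕₚ.+-monoˡ-≤ (nonEdges full ⊓ 1) (ℕₚ.+-mono-≤ (ℕₚ.≤-reflexive edges-full) colors-full)

  nonEdges≡0⇒Complete : nonEdges full ≡ 0 → Complete G
  nonEdges≡0⇒Complete none u v u≢v = Adj-joins (sortPair-joins u v)
    (nonEdges≡0⇒adjacent full none (pairIn⁺ full (sortPair-joins u v) (sortPair-ordered u≢v) _ _))

  nonRepDegree : VertexSet → V → ℕ
  nonRepDegree S x = count (λ p → (edgeIn S p ∧ incident x p) ∧ not (isRep S p)) pairs

  ownedColors+nonRepDegree≤degree : ∀ S x → ownedColors S x + nonRepDegree S x ≤ degree S x
  ownedColors+nonRepDegree≤degree S x = begin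
    ownedColors S x + nonRepDegree S x
      ≤⟨ ℕₚ.+-monoˡ-≤ (nonRepDegree S x) (count-mono pairs owned⇒rep-at-x) ⟩
    count (λ p → (edgeIn S p ∧ incident x p) ∧ isRep S p) pairs + nonRepDegree S x
      ≡⟨ sym (count-split pairs (λ p → edgeIn S p ∧ incident x p) (isRep S)) ⟩
    degree S x ∎
    where
    open ℕₚ.≤-Reasoning
    owned⇒rep-at-x : ∀ {p} → T (isRep S p ∧ owns S x (pairColor p)) → T ((edgeIn S p ∧ incident x p) ∧ isRep S p)
    owned⇒rep-at-x {p} h = let (rep , own) = Equivalence.to (T-∧ {isRep S p}) h
                               e-p = isRep⇒edgeIn S p rep
                           in Equivalence.from T-∧
                                (Equivalence.from T-∧ (e-p , owns⇒incident S x own (hasColor⁺ S p e-p refl)) , rep)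

  owner-of-repeated : ∀ S {p} → unownedRepeatedColors S ≡ 0 → T (isRep S p) → T (repeated S p) →
                      ∃ λ x → T (S x) × T (owns S x (pairColor p))
  owner-of-repeated S {p} none rep rpt with owners S p in owned
  ... | zero  = ⊥-elim (ℕₚ.<-irrefl (sym none)
                  (count≥1 (∈-pairs p) (Equivalence.from T-∧
                     (rep , Equivalence.from T-∧ (rpt , subst (λ k → T (k ≡ᵇ 0)) (sym owned) _)))))
  ... | suc _ with count-∃ vertices (subst (1 ≤_) (sym owned) (s≤s z≤n))
  ...   | x , _ , h = x , Equivalence.to (T-∧ {S x}) h

  -- With a single repeated color, two surplus edges share it with its representative, and
  -- an owner of that color lies on all three.
  crowded-owner : ∀ S → repeatedColors S ≤ 1 → 2 ≤ nonReps S → unownedRepeatedColors S ≡ 0 →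
                  ∃ λ x → T (S x) × ownedColors S x + 2 ≤ degree S x
  crowded-owner S one-repeated two-nonReps none with distinct-witnesses pairs! two-nonReps
  ... | q₁ , q₂ , q₁≢q₂ , nonRep₁ , nonRep₂
    with nonRep⁻ S q₁ nonRep₁ | nonRep⁻ S q₂ nonRep₂
  ... | e₁ , ¬rep₁ | e₂ , ¬rep₂
    with nonRep⇒repeated S e₁ ¬rep₁ | nonRep⇒repeated S e₂ ¬rep₂
  ... | p , rep , rpt , color₁ | p₂ , rep₂ , rpt₂ , color₂
    with owner-of-repeated S none rep rpt
  ... | x , x∈S , own =
    x , x∈S , ℕₚ.≤-trans (ℕₚ.+-monoʳ-≤ (ownedColors S x) two-at-x) (ownedColors+nonRepDegree≤degree S x)
    where
    p≡p₂ : p ≡ p₂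
    p≡p₂ with p ≟ᵖ p₂
    ... | yes p≡p₂ = p≡p₂
    ... | no p≢p₂  = ⊥-elim (ℕₚ.<-irrefl refl (ℕₚ.≤-trans
            (count≥2 p≢p₂ (∈-pairs p) (∈-pairs p₂)
               (Equivalence.from T-∧ (rep , rpt)) (Equivalence.from T-∧ (rep₂ , rpt₂)))
            one-repeated))
    at-x : ∀ {q} → T (edgeIn S q) → ¬ T (isRep S q) → pairColor q ≡ pairColor p →
           T ((edgeIn S q ∧ incident x q) ∧ not (isRep S q))
    at-x {q} e-q ¬rep same = Equivalence.from T-∧
      (Equivalence.from T-∧ (e-q , owns⇒incident S x own (hasColor⁺ S q e-q same)) , ¬T⇒T-not (isRep S q) ¬rep)
    two-at-x : 2 ≤ nonRepDegree S x
    two-at-x = count≥2 q₁≢q₂ (∈-pairs q₁) (∈-pairs q₂)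
                 (at-x e₁ ¬rep₁ (sym color₁)) (at-x e₂ ¬rep₂ (trans (sym color₂) (cong pairColor (sym p≡p₂))))

profileWeight : ℕ → ℕ → ℕ → ℕ
profileWeight m e c = e + c + (m C 2 ∸ e) ⊓ 1

-- Constraints on the numbers e, c, t of edges, colors and repeated colors of an m-vertex set
-- whose (m - 1)-subsets all have weight at most K - (m - 1).
Admissible : (m K e c t : ℕ) → Set
Admissible m K e c t =
  (c < e → 1 ≤ t) × (c ≡ e → m < m C 2 ∸ e + 5) × (m * profileWeight m e c + t ≤ 2 * c + m * K)

admissible? : ∀ m K e c t → Dec (Admissible m K e c t)
admissible? m K e c t =
  (c <? e →-dec 1 ≤? t) ×-dec (c ≟ e →-dec m <? m C 2 ∸ e + 5) ×-dec (m * profileWeight m e c + t ≤? 2 * c + m * K)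

Bounded : (m K : ℕ) → (ℕ → ℕ → ℕ → Set) → Set
Bounded m K Goal = ∀ {e} → e < suc (m C 2) → ∀ {c} → c < suc e → ∀ {t} → t < suc c →
                   Admissible m K e c t → Goal e c t

bounded? : ∀ m K {Goal : ℕ → ℕ → ℕ → Set} → (∀ e c t → Dec (Goal e c t)) → Dec (Bounded m K Goal)
bounded? m K goal? =
  allUpTo? (λ e → allUpTo? (λ c → allUpTo? (λ t → admissible? m K e c t →-dec goal? e c t) (suc c)) (suc e)) (suc (m C 2))

admissible-profiles₇ : Bounded 7 34 (λ e c t → profileWeight 7 e c ≤ 38 ⊎ (c ≡ 18 × t ≡ 1 × c + 2 ≤ e))
admissible-profiles₇ =
  from-yes (bounded? 7 34 λ e c t → profileWeight 7 e c ≤? 38 ⊎-dec (c ≟ 18 ×-dec t ≟ 1 ×-dec c + 2 ≤? e))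

module Bounds {n : ℕ} (G : ColoredGraph n) (no-K₅ : ¬ RainbowK G 5) where
  open Vertices n
  open Coloring G

  nonEdges≡ : ∀ S {m} → size S ≡ m → nonEdges S ≡ m C 2 ∸ edges S
  nonEdges≡ S {m} size≡ = begin
    nonEdges S                          ≡⟨ sym (ℕₚ.m+n∸m≡n (edges S) (nonEdges S)) ⟩
    edges S + nonEdges S ∸ edges S      ≡⟨ cong (_∸ edges S) (trans (edges+nonEdges S) (pairsIn-size m S size≡)) ⟩
    m C 2 ∸ edges S                     ∎
    where open ≡-Reasoning

  weight≡profileWeight : ∀ S {m} → size S ≡ m → weight S ≡ profileWeight m (edges S) (colors S)
  weight≡profileWeight S size≡ = cong (λ N → edges S + colors S + N ⊓ 1) (nonEdges≡ S size≡)

  in-range : ∀ S {m} → size S ≡ m → edges S < suc (m C 2) × colors S < suc (edges S) × repeatedColors S < suc (colors S)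
  in-range S {m} size≡ =
    s≤s (subst (edges S ≤_) (trans (edges+nonEdges S) (pairsIn-size m S size≡)) (ℕₚ.m≤m+n (edges S) (nonEdges S))) ,
    s≤s (colors≤edges S) ,
    s≤s (count-mono pairs (λ {p} h → proj₁ (Equivalence.to (T-∧ {isRep S p}) h)))

  admissible : ∀ {m B} → WeightBound m B → ∀ S → size S ≡ suc m →
               Admissible (suc m) (B + m) (edges S) (colors S) (repeatedColors S)
  admissible {m} {B} bound S size≡ = repeatedColors-pos S , no-clique , averaged
    where
    no-clique : colors S ≡ edges S → suc m < suc m C 2 ∸ edges S + 5
    no-clique c≡e = ℕₚ.≰⇒> λ room → no-K₅ (rainbowK (suc m) S size≡ (colors≡edges⇒Rainbow S c≡e)
                                             (subst (λ N → N + 5 ≤ suc m) (sym (nonEdges≡ S size≡)) room))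
    averaged : suc m * profileWeight (suc m) (edges S) (colors S) + repeatedColors S ≤ 2 * colors S + suc m * (B + m)
    averaged = subst (λ x → suc m * x + repeatedColors S ≤ 2 * colors S + suc m * (B + m)) (weight≡profileWeight S size≡)
                 (ℕₚ.≤-trans (ℕₚ.m≤m+n _ (unownedRepeatedColors S)) (averaging bound S size≡))

  bound₀ : WeightBound 0 0
  bound₀ S size≡0 with edges S | colors S | in-range S size≡0 | weight≡profileWeight S size≡0
  ... | _ | _ | s≤s z≤n , s≤s z≤n , _ | weight≡0 = ℕₚ.≤-reflexive weight≡0

  bound-step : ∀ {m B} → WeightBound m B → ∀ B′ →
               {True (bounded? (suc m) (B + m) (λ e c _ → profileWeight (suc m) e c ≤? B′))} →
               WeightBound (suc m) B′
  bound-step {m} {B} bound B′ {check} S size≡ =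
    let (e< , c< , t<) = in-range S size≡ in
    subst (_≤ B′) (sym (weight≡profileWeight S size≡)) (toWitness check e< c< t< (admissible bound S size≡))

  bound₆ : WeightBound 6 28
  bound₆ = bound-step (bound-step (bound-step (bound-step (bound-step (bound-step bound₀ 0) 2) 6) 12) 19) 28

  -- If weight S > 38, every vertex owns at least 5 colors, so the unique repeated color is owned;
  -- its owner lies on that color's representative and on two further edges, so it owns at most 4.
  exception₇-bound : ∀ S → size S ≡ 7 → colors S ≡ 18 → repeatedColors S ≡ 1 → colors S + 2 ≤ edges S →
                     weight S ≤ 38
  exception₇-bound S size≡7 c≡18 t≡1 c+2≤e with weight S ≤? 38
  ... | yes light = light
  ... | no heavy = ⊥-elim (no-crowded-owner (crowded-owner S (ℕₚ.≤-reflexive t≡1) two-nonReps unowned≡0))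
    where
    owned≥5 : ∀ {w} → T (S w) → 5 ≤ ownedColors S w
    owned≥5 w∈S = ℕₚ.+-cancelʳ-≤ 34 5 _ (ℕₚ.≤-trans (ℕₚ.≰⇒> heavy) (weight-bound-at bound₆ S w∈S size≡7))
    owned-sum : 35 ≤ ∑[ w ← vertices ] (𝟙 (S w) * ownedColors S w)
    owned-sum = subst (_≤ ∑[ w ← vertices ] (𝟙 (S w) * ownedColors S w)) (trans (∑-indicator S 5) (cong (_* 5) size≡7))
                  (∑-indicator-mono S (λ _ → owned≥5))
    unowned≡0 : unownedRepeatedColors S ≡ 0
    unowned≡0 = ℕₚ.n≤0⇒n≡0 (ℕₚ.+-cancelˡ-≤ 36 (unownedRepeatedColors S) 0 (begin
      36 + unownedRepeatedColors S
        ≤⟨ ℕₚ.+-monoˡ-≤ (unownedRepeatedColors S) (ℕₚ.+-mono-≤ owned-sum (ℕₚ.≤-reflexive (sym t≡1))) ⟩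
      ∑[ w ← vertices ] (𝟙 (S w) * ownedColors S w) + repeatedColors S + unownedRepeatedColors S
        ≤⟨ ownership-bound S ⟩
      2 * colors S
        ≡⟨ cong (2 *_) c≡18 ⟩
      36 ∎))
      where open ℕₚ.≤-Reasoning
    two-nonReps : 2 ≤ nonReps S
    two-nonReps = ℕₚ.+-cancelˡ-≤ (colors S) 2 (nonReps S) (subst (colors S + 2 ≤_) (edges≡colors+nonReps S) c+2≤e)
    no-crowded-owner : ¬ ∃ λ x → T (S x) × ownedColors S x + 2 ≤ degree S x
    no-crowded-owner (x , x∈S , crowded) =
      ℕₚ.<-irrefl refl (ℕₚ.≤-trans (ℕₚ.+-monoˡ-≤ 2 (owned≥5 x∈S)) (ℕₚ.≤-trans crowded degree≤6))
      where
      degree≤6 : degree S x ≤ 6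
      degree≤6 = subst (degree S x ≤_)
        (trans (degree+nonDegree S x) (trans (pairsAt-size S x∈S) (ℕₚ.suc-injective (trans (sym (size-remove S x∈S)) size≡7))))
        (ℕₚ.m≤m+n (degree S x) (nonDegree S x))

  bound₇ : WeightBound 7 38
  bound₇ S size≡7 = let (e< , c< , t<) = in-range S size≡7 in
    conclude (admissible-profiles₇ e< c< t< (admissible bound₆ S size≡7))
    where
    conclude : profileWeight 7 (edges S) (colors S) ≤ 38 ⊎
               (colors S ≡ 18 × repeatedColors S ≡ 1 × colors S + 2 ≤ edges S) → weight S ≤ 38
    conclude (inj₁ light)                   = subst (_≤ 38) (sym (weight≡profileWeight S size≡7)) light
    conclude (inj₂ (c≡18 , t≡1 , c+2≤e)) = exception₇-bound S size≡7 c≡18 t≡1 c+2≤e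

  bound₉ : WeightBound 9 64
  bound₉ = bound-step (bound-step bound₇ 50) 64

lemma6 : (G : ColoredGraph 9) → e G + c G ≡ 64 → ¬ RainbowK G 5 → Complete G
lemma6 G e+c≡64 no-K₅ = nonEdges≡0⇒Complete (⊓1≡0⇒≡0 (ℕₚ.n≤0⇒n≡0 (ℕₚ.+-cancelˡ-≤ 64 _ 0 (begin
  64 + nonEdges full ⊓ 1          ≡⟨ cong (_+ nonEdges full ⊓ 1) (sym e+c≡64) ⟩
  e G + c G + nonEdges full ⊓ 1   ≤⟨ e+c+incomplete≤weight ⟩
  weight full                     ≤⟨ bound₉ full refl ⟩
  64 + 0                          ∎))))
  where
  open Vertices 9
  open Coloring G
  open Bounds G no-K₅
  open ℕₚ.≤-Reasoning
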